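{- Let $G$ be a finite connected multigraph and let $D\in\operatorname{Div}(G)$ satisfy $\chi(V(G),D)\ge 0$ and $\chi_D<0$. Then $\mathbf S(D)$ has a unique minimal element with respect to inclusion.
   Context: $\operatorname{Div}(G)$ is the free abelian group on $V(G)$. For $S\subseteq V(G)$, $e(S)$ is the number of edges with both endpoints in $S$, $D|_S$ is the restriction of $D$ to $S$, and $\chi(S,D)=\deg(D|_S)+|S|-e(S)$. Define $\chi_D=\min\{\chi(S,D):\emptyset\neq S\subsetneq V(G)\}$ and $\mathbf S(D)=\{S:\emptyset\ne S\subsetneq V(G),\ \chi(S,D)=\chi_D\}$. -}

module Defs where

open import Data.Nat using (ℕ)
open import Data.Bool using (Bool; true; false; if_then_else_; _∧_)
open import Data.Fin using (Fin)
open import Data.Fin.Subset using (Subset; ∣_∣; Nonempty; _⊆_; _⊂_; ⊤)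
open import Data.Integer using (ℤ; +_; _+_; _-_; _≤_)
open import Data.List using (List; map; allFin; foldr)
open import Data.List.Relation.Unary.All using (All)
open import Data.Product using (_×_; _,_; proj₁; proj₂; ∃)
open import Data.Vec using (lookup)
open import Relation.Binary.PropositionalEquality using (_≡_; _≢_)
open import Relation.Binary.Construct.Closure.ReflexiveTransitive using (Star)
open import Data.Sum using (_⊎_)

record Multigraph (n : ℕ) : Set where
  field
    edges    : List (Fin n × Fin n)
    loopless : All (λ e → proj₁ e ≢ proj₂ e) edges

open Multigraph public

Adj : ∀ {n} → Multigraph n → Fin n → Fin n → Set
Adj G u v = Data.List.Membership.Propositional._∈_ (u , v) (edges G)
          ⊎ Data.List.Membership.Propositional._∈_ (v , u) (edges G)
  where import Data.List.Membership.Propositional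

Connected : ∀ {n} → Multigraph n → Set
Connected G = ∀ u v → Star (Adj G) u v

Div : ℕ → Set
Div n = Fin n → ℤ

degOn : ∀ {n} → Div n → Subset n → ℤ
degOn {n} D S = foldr (λ v acc → (if lookup S v then D v else + 0) + acc) (+ 0) (allFin n)

e : ∀ {n} → Multigraph n → Subset n → ℕ
e G S = foldr (λ ed acc → if lookup S (proj₁ ed) ∧ lookup S (proj₂ ed)
                           then Data.Nat.suc acc else acc) 0 (edges G)

χ : ∀ {n} → Multigraph n → Subset n → Div n → ℤ
χ G S D = degOn D S + + ∣ S ∣ - + e G S

Proper : ∀ {n} → Subset n → Set
Proper S = Nonempty S × S ⊂ ⊤

-- χ_D < 0  (χ_D = min of χ(S,D) over proper nonempty S)
χD<0 : ∀ {n} → Multigraph n → Div n → Set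
χD<0 G D = ∃ λ S → Proper S × χ G S D Data.Integer.< + 0

_∈𝐒[_,_] : ∀ {n} → Subset n → Multigraph n → Div n → Set
S ∈𝐒[ G , D ] = Proper S × (∀ T → Proper T → χ G S D ≤ χ G T D)

Minimal𝐒 : ∀ {n} → Multigraph n → Div n → Subset n → Set
Minimal𝐒 G D S = S ∈𝐒[ G , D ] × (∀ T → T ∈𝐒[ G , D ] → T ⊆ S → T ≡ S)

-- χ(·, D) is submodular, since deg(D|_S) and |S| are modular in S while e(S) is
-- supermodular. Let S and U be inclusion-minimal minimisers over the proper nonempty
-- subsets, with negative minimum m. Then S ∪ U is either V(G), where χ ≥ 0 > m, or
-- proper, so χ(S ∪ U) ≥ m and submodularity gives χ(S ∩ U) ≤ m. As χ(∅) = 0 > m, the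
-- set S ∩ U is a proper minimiser contained in both, whence S = S ∩ U = U. A minimiser
-- of least cardinality is inclusion-minimal, which gives existence.

module Submission where

open import Defs
open import Data.Nat using (ℕ)
open import Data.Integer using (+_; _≤_)
open import Data.Fin.Subset using (⊤)
open import Data.Product using (_×_; ∃)
open import Relation.Binary.PropositionalEquality using (_≡_)

open import Data.Bool using (Bool; true; false; if_then_else_; _∧_; _∨_; T)
import Data.Bool.Properties as Bool
open import Data.Empty using (⊥-elim)
open import Data.Fin using (Fin; zero; suc)
open import Data.Fin.Subset
  using (Subset; inside; outside; ∣_∣; _∪_; _∩_; ⊥; _∈_; _∉_; _⊆_; _⊂_; Nonempty)
open import Data.Fin.Subset.Properties
  using (∣⊥∣≡0; ∈⊤; ⊆⊤; drop-∷-⊆; p⊆q⇒∣p∣≤∣q∣; p⊆p∪q; p∩q⊆p; p∩q⊆q; Empty-unique; nonempty?; _⊂?_)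
open import Data.Integer using (ℤ; +≤+; _+_; _-_; -_; _<_)
import Data.Integer.Properties as ℤ
open import Data.Integer.Tactic.RingSolver using (solve-∀)
open import Data.List using (List; []; _∷_; foldr; allFin)
open import Data.Nat as ℕ using (zero; suc)
import Data.Nat.Properties as ℕ
open import Algebra.Properties.CommutativeSemigroup ℤ.+-commutativeSemigroup
  using () renaming (interchange to ℤ-+-interchange)
open import Algebra.Properties.CommutativeSemigroup ℕ.+-commutativeSemigroup
  using () renaming (interchange to ℕ-+-interchange)
open import Data.Product using (_,_; proj₁; proj₂)
open import Data.Sum using (_⊎_; inj₁; inj₂)
open import Data.Unit using (tt)
open import Data.Vec using ([]; _∷_; lookup; here; there)
open import Data.Vec.Properties using (lookup-zipWith; lookup-replicate; ≡-dec)
open import Function using (_∘_)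
open import Relation.Binary.Bundles using (TotalPreorder)
open import Relation.Binary.PropositionalEquality
  using (_≢_; refl; sym; trans; cong; cong₂; subst; subst₂; module ≡-Reasoning)
open import Relation.Nullary using (yes; no)
open import Relation.Nullary.Decidable using (_×-dec_)
open import Relation.Unary using (Pred; Decidable; Empty; Satisfiable)

module Minimisation {c ℓ₁ ℓ₂} (O : TotalPreorder c ℓ₁ ℓ₂) where
  open TotalPreorder O using (_≲_; total) renaming (Carrier to B; refl to ≲-refl; trans to ≲-trans)

  Minimises : ∀ {n p} → (Subset n → B) → Pred (Subset n) p → Pred (Subset n) _
  Minimises f P S = P S × (∀ T → P T → f S ≲ f T)

  minimise : ∀ {n p} (f : Subset n → B) {P : Pred (Subset n) p} →
             Decidable P → Empty P ⊎ ∃ (Minimises f P)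
  minimise {zero} f P? with P? []
  ... | yes p = inj₂ ([] , p , λ { [] _ → ≲-refl })
  ... | no ¬p = inj₁ λ { [] → ¬p }
  minimise {suc n} f P?
    with minimise (f ∘ (inside ∷_)) (P? ∘ (inside ∷_))
       | minimise (f ∘ (outside ∷_)) (P? ∘ (outside ∷_))
  ... | inj₁ noneᵢ | inj₁ noneₒ =
    inj₁ λ { (inside ∷ T) → noneᵢ T ; (outside ∷ T) → noneₒ T }
  ... | inj₂ (S , pS , minS) | inj₁ noneₒ =
    inj₂ (inside ∷ S , pS , λ { (inside ∷ T) → minS T ; (outside ∷ T) pT → ⊥-elim (noneₒ T pT) })
  ... | inj₁ noneᵢ | inj₂ (S , pS , minS) =
    inj₂ (outside ∷ S , pS , λ { (inside ∷ T) pT → ⊥-elim (noneᵢ T pT) ; (outside ∷ T) → minS T })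
  ... | inj₂ (S , pS , minS) | inj₂ (S′ , pS′ , minS′) with total (f (inside ∷ S)) (f (outside ∷ S′))
  ...   | inj₁ S≲S′ = inj₂ (inside ∷ S , pS ,
          λ { (inside ∷ T) → minS T ; (outside ∷ T) pT → ≲-trans S≲S′ (minS′ T pT) })
  ...   | inj₂ S′≲S = inj₂ (outside ∷ S′ , pS′ ,
          λ { (inside ∷ T) pT → ≲-trans S′≲S (minS T pT) ; (outside ∷ T) → minS′ T })

  minimiser : ∀ {n p} (f : Subset n → B) {P : Pred (Subset n) p} →
              Decidable P → Satisfiable P → ∃ (Minimises f P)
  minimiser f P? (S , pS) with minimise f P?
  ... | inj₁ none = ⊥-elim (none S pS)
  ... | inj₂ min = min

+-cancelˡ-≤ : ∀ i {j k} → i + j ≤ i + k → j ≤ k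
+-cancelˡ-≤ i {j} {k} i+j≤i+k = begin
  j               ≡⟨ cancel i j ⟨
  - i + (i + j)   ≤⟨ ℤ.+-monoʳ-≤ (- i) i+j≤i+k ⟩
  - i + (i + k)   ≡⟨ cancel i k ⟩
  k               ∎
  where
  open ℤ.≤-Reasoning
  cancel : ∀ i j → - i + (i + j) ≡ j
  cancel = solve-∀

p≢⊤⇒p⊂⊤ : ∀ {n} {p : Subset n} → p ≢ ⊤ → p ⊂ ⊤
p≢⊤⇒p⊂⊤ {p = p} p≢⊤ = ⊆⊤ , missing p p≢⊤
  where
  missing : ∀ {n} (p : Subset n) → p ≢ ⊤ → ∃ λ x → x ∈ ⊤ × x ∉ p
  missing []            []≢⊤  = ⊥-elim ([]≢⊤ refl)
  missing (outside ∷ p) _     = zero , ∈⊤ , λ ()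
  missing (inside ∷ p)  ip≢⊤ with missing p (ip≢⊤ ∘ cong (inside ∷_))
  ... | x , _ , x∉p = suc x , ∈⊤ , λ { (there x∈p) → x∉p x∈p }

p⊆q⇒∣q∣≤∣p∣⇒p≡q : ∀ {n} {p q : Subset n} → p ⊆ q → ∣ q ∣ ℕ.≤ ∣ p ∣ → p ≡ q
p⊆q⇒∣q∣≤∣p∣⇒p≡q {p = []}          {[]}          _   _       = refl
p⊆q⇒∣q∣≤∣p∣⇒p≡q {p = outside ∷ p} {outside ∷ q} p⊆q ∣q∣≤∣p∣ =
  cong (outside ∷_) (p⊆q⇒∣q∣≤∣p∣⇒p≡q (drop-∷-⊆ p⊆q) ∣q∣≤∣p∣)
p⊆q⇒∣q∣≤∣p∣⇒p≡q {p = outside ∷ p} {inside  ∷ q} p⊆q ∣q∣<∣p∣ =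
  ⊥-elim (ℕ.<-irrefl refl (ℕ.≤-trans ∣q∣<∣p∣ (p⊆q⇒∣p∣≤∣q∣ (drop-∷-⊆ p⊆q))))
p⊆q⇒∣q∣≤∣p∣⇒p≡q {p = inside  ∷ p} {outside ∷ q} p⊆q _       with () ← p⊆q here
p⊆q⇒∣q∣≤∣p∣⇒p≡q {p = inside  ∷ p} {inside  ∷ q} p⊆q ∣q∣≤∣p∣ =
  cong (inside ∷_) (p⊆q⇒∣q∣≤∣p∣⇒p≡q (drop-∷-⊆ p⊆q) (ℕ.s≤s⁻¹ ∣q∣≤∣p∣))

Proper? : ∀ {n} → Decidable (Proper {n})
Proper? S = nonempty? S ×-dec (S ⊂? ⊤)

⊆-Proper : ∀ {n} {S T : Subset n} → Nonempty T → T ⊆ S → Proper S → Proper T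
⊆-Proper T≠∅ T⊆S (_ , _ , x , _ , x∉S) = T≠∅ , ⊆⊤ , x , ∈⊤ , x∉S ∘ T⊆S

∣p∪q∣+∣p∩q∣≡∣p∣+∣q∣ : ∀ {n} (p q : Subset n) → ∣ p ∪ q ∣ ℕ.+ ∣ p ∩ q ∣ ≡ ∣ p ∣ ℕ.+ ∣ q ∣
∣p∪q∣+∣p∩q∣≡∣p∣+∣q∣ []            []            = refl
∣p∪q∣+∣p∩q∣≡∣p∣+∣q∣ (inside  ∷ p) (inside  ∷ q) = cong suc (begin
  ∣ p ∪ q ∣ ℕ.+ suc ∣ p ∩ q ∣ ≡⟨ ℕ.+-suc ∣ p ∪ q ∣ ∣ p ∩ q ∣ ⟩
  suc (∣ p ∪ q ∣ ℕ.+ ∣ p ∩ q ∣) ≡⟨ cong suc (∣p∪q∣+∣p∩q∣≡∣p∣+∣q∣ p q) ⟩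
  suc (∣ p ∣ ℕ.+ ∣ q ∣)         ≡⟨ ℕ.+-suc ∣ p ∣ ∣ q ∣ ⟨
  ∣ p ∣ ℕ.+ suc ∣ q ∣ ∎)
  where open ≡-Reasoning
∣p∪q∣+∣p∩q∣≡∣p∣+∣q∣ (inside  ∷ p) (outside ∷ q) = cong suc (∣p∪q∣+∣p∩q∣≡∣p∣+∣q∣ p q)
∣p∪q∣+∣p∩q∣≡∣p∣+∣q∣ (outside ∷ p) (inside  ∷ q) =
  trans (cong suc (∣p∪q∣+∣p∩q∣≡∣p∣+∣q∣ p q)) (sym (ℕ.+-suc ∣ p ∣ ∣ q ∣))
∣p∪q∣+∣p∩q∣≡∣p∣+∣q∣ (outside ∷ p) (outside ∷ q) = ∣p∪q∣+∣p∩q∣≡∣p∣+∣q∣ p q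

Submodular : ∀ {n} → (Subset n → ℤ) → Set
Submodular f = ∀ S U → f (S ∪ U) + f (S ∩ U) ≤ f S + f U

module _ {n : ℕ} (f : Subset n → ℤ) where

  open Minimisation ℤ.≤-totalPreorder using (Minimises; minimiser)

  ProperMinimiser : Pred (Subset n) _
  ProperMinimiser = Minimises f Proper

  MinimalProperMinimiser : Pred (Subset n) _
  MinimalProperMinimiser S = ProperMinimiser S × (∀ T → ProperMinimiser T → T ⊆ S → T ≡ S)

  minimalProperMinimiser : Satisfiable Proper → ∃ MinimalProperMinimiser
  minimalProperMinimiser proper with minimiser f Proper? proper
  ... | S₀ , S₀-proper , S₀-min
    with Minimisation.minimiser ℕ.≤-totalPreorder ∣_∣
           (λ S → Proper? S ×-dec (f S ℤ.≟ f S₀)) (S₀ , S₀-proper , refl)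
  ... | S , (S-proper , fS≡fS₀) , S-smallest = S , S-minimiser , S-minimal
    where
    S-minimiser : ProperMinimiser S
    S-minimiser = S-proper , λ T T-proper → subst (_≤ f T) (sym fS≡fS₀) (S₀-min T T-proper)
    S-minimal : ∀ T → ProperMinimiser T → T ⊆ S → T ≡ S
    S-minimal T (T-proper , T-min) T⊆S = p⊆q⇒∣q∣≤∣p∣⇒p≡q T⊆S (S-smallest T (T-proper , fT≡fS₀))
      where
      fT≡fS₀ : f T ≡ f S₀
      fT≡fS₀ = ℤ.≤-antisym (subst (f T ≤_) fS≡fS₀ (T-min S S-proper)) (S₀-min T T-proper)

  module _ (submodular : Submodular f) (f⊥≡0 : f ⊥ ≡ + 0) (0≤f⊤ : + 0 ≤ f ⊤) where

    ∩-properMinimiser : ∀ {S U} → ProperMinimiser S → f S < + 0 → ProperMinimiser U →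
                        ProperMinimiser (S ∩ U)
    ∩-properMinimiser {S} {U} (S-proper , S-min) fS<0 (U-proper , U-min) =
      ⊆-Proper S∩U≠∅ (p∩q⊆p S U) S-proper , λ T T-proper → ℤ.≤-trans f[S∩U]≤fU (U-min T T-proper)
      where
      S∪U≠∅ : Nonempty (S ∪ U)
      S∪U≠∅ = proj₁ (proj₁ S-proper) , p⊆p∪q U (proj₂ (proj₁ S-proper))
      fS≤f[S∪U] : f S ≤ f (S ∪ U)
      fS≤f[S∪U] with ≡-dec Bool._≟_ (S ∪ U) ⊤
      ... | yes S∪U≡⊤ = subst (λ X → f S ≤ f X) (sym S∪U≡⊤) (ℤ.≤-trans (ℤ.<⇒≤ fS<0) 0≤f⊤)
      ... | no  S∪U≢⊤ = S-min (S ∪ U) (S∪U≠∅ , p≢⊤⇒p⊂⊤ S∪U≢⊤)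
      f[S∩U]≤fU : f (S ∩ U) ≤ f U
      f[S∩U]≤fU = +-cancelˡ-≤ (f S) (ℤ.≤-trans (ℤ.+-monoˡ-≤ (f (S ∩ U)) fS≤f[S∪U]) (submodular S U))
      S∩U≠∅ : Nonempty (S ∩ U)
      S∩U≠∅ with nonempty? (S ∩ U)
      ... | yes S∩U≠∅ = S∩U≠∅
      ... | no  S∩U≡∅ = ⊥-elim (ℤ.<-irrefl refl (ℤ.≤-<-trans 0≤fS fS<0))
        where
        0≤fS : + 0 ≤ f S
        0≤fS = begin
          + 0       ≡⟨ f⊥≡0 ⟨
          f ⊥       ≡⟨ cong f (Empty-unique S∩U≡∅) ⟨
          f (S ∩ U) ≤⟨ f[S∩U]≤fU ⟩
          f U       ≤⟨ U-min S S-proper ⟩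
          f S       ∎
          where open ℤ.≤-Reasoning

    minimalProperMinimiser-unique : (∃ λ T → Proper T × f T < + 0) →
      ∀ {S U} → MinimalProperMinimiser S → MinimalProperMinimiser U → S ≡ U
    minimalProperMinimiser-unique (T , T-proper , fT<0) {S} {U}
                                  (S-min , S-minimal) (U-min , U-minimal) =
      trans (sym (S-minimal (S ∩ U) S∩U-min (p∩q⊆p S U))) (U-minimal (S ∩ U) S∩U-min (p∩q⊆q S U))
      where
      S∩U-min : ProperMinimiser (S ∩ U)
      S∩U-min = ∩-properMinimiser S-min (ℤ.≤-<-trans (proj₂ S-min T T-proper) fT<0) U-min

indicator : Bool → ℕ
indicator b = if b then 1 else 0

sumBy : ∀ {a} {A : Set a} → (A → ℤ) → List A → ℤ
sumBy g = foldr (λ x acc → g x + acc) (+ 0)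

countBy : ∀ {a} {A : Set a} → (A → Bool) → List A → ℕ
countBy c = foldr (λ x acc → if c x then suc acc else acc) 0

module _ {a} {A : Set a} where

  sumBy-+ : ∀ (g h : A → ℤ) xs → sumBy g xs + sumBy h xs ≡ sumBy (λ x → g x + h x) xs
  sumBy-+ g h []       = refl
  sumBy-+ g h (x ∷ xs) = begin
    (g x + sumBy g xs) + (h x + sumBy h xs) ≡⟨ ℤ-+-interchange (g x) _ (h x) _ ⟩
    (g x + h x) + (sumBy g xs + sumBy h xs) ≡⟨ cong (_+_ (g x + h x)) (sumBy-+ g h xs) ⟩
    (g x + h x) + sumBy (λ x → g x + h x) xs ∎
    where open ≡-Reasoning

  sumBy-cong : ∀ {g h : A → ℤ} → (∀ x → g x ≡ h x) → ∀ xs → sumBy g xs ≡ sumBy h xs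
  sumBy-cong g≗h []       = refl
  sumBy-cong g≗h (x ∷ xs) = cong₂ _+_ (g≗h x) (sumBy-cong g≗h xs)

  sumBy-zero : ∀ {g : A → ℤ} → (∀ x → g x ≡ + 0) → ∀ xs → sumBy g xs ≡ + 0
  sumBy-zero g≗0 []       = refl
  sumBy-zero g≗0 (x ∷ xs) rewrite g≗0 x | sumBy-zero g≗0 xs = refl

  countBy-false : ∀ {c : A → Bool} → (∀ x → c x ≡ false) → ∀ xs → countBy c xs ≡ 0
  countBy-false c≗false []       = refl
  countBy-false c≗false (x ∷ xs) rewrite c≗false x = countBy-false c≗false xs

  countBy-∷ : ∀ (c : A → Bool) x xs → countBy c (x ∷ xs) ≡ indicator (c x) ℕ.+ countBy c xs
  countBy-∷ c x xs with c x
  ... | true  = refl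
  ... | false = refl

  countBy-+-mono-≤ : ∀ {c₁ c₂ c₃ c₄ : A → Bool} →
    (∀ x → indicator (c₁ x) ℕ.+ indicator (c₂ x) ℕ.≤ indicator (c₃ x) ℕ.+ indicator (c₄ x)) →
    ∀ xs → countBy c₁ xs ℕ.+ countBy c₂ xs ℕ.≤ countBy c₃ xs ℕ.+ countBy c₄ xs
  countBy-+-mono-≤ pointwise [] = ℕ.z≤n
  countBy-+-mono-≤ {c₁} {c₂} {c₃} {c₄} pointwise (x ∷ xs)
    rewrite countBy-∷ c₁ x xs | countBy-∷ c₂ x xs | countBy-∷ c₃ x xs | countBy-∷ c₄ x xs
          | ℕ-+-interchange (indicator (c₁ x)) (countBy c₁ xs) (indicator (c₂ x)) (countBy c₂ xs)
          | ℕ-+-interchange (indicator (c₃ x)) (countBy c₃ xs) (indicator (c₄ x)) (countBy c₄ xs)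
    = ℕ.+-mono-≤ (pointwise x) (countBy-+-mono-≤ pointwise xs)

select : Bool → ℤ → ℤ
select b d = if b then d else + 0

select-∨-∧ : ∀ a b d → select (a ∨ b) d + select (a ∧ b) d ≡ select a d + select b d
select-∨-∧ true  true  d = refl
select-∨-∧ true  false d = refl
select-∨-∧ false true  d = ℤ.+-comm d (+ 0)
select-∨-∧ false false d = refl

indicator-∧-supermodular : ∀ a b c d →
  indicator (a ∧ c) ℕ.+ indicator (b ∧ d)
    ℕ.≤ indicator ((a ∨ b) ∧ (c ∨ d)) ℕ.+ indicator ((a ∧ b) ∧ (c ∧ d))
indicator-∧-supermodular a b c d = ℕ.≤ᵇ⇒≤ _ _ (table a b c d)
  where
  table : ∀ a b c d → T (indicator (a ∧ c) ℕ.+ indicator (b ∧ d) ℕ.≤ᵇ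
                         indicator ((a ∨ b) ∧ (c ∨ d)) ℕ.+ indicator ((a ∧ b) ∧ (c ∧ d)))
  table true  true  true  true  = tt
  table true  true  true  false = tt
  table true  true  false true  = tt
  table true  true  false false = tt
  table true  false true  true  = tt
  table true  false true  false = tt
  table true  false false true  = tt
  table true  false false false = tt
  table false true  true  true  = tt
  table false true  true  false = tt
  table false true  false true  = tt
  table false true  false false = tt
  table false false true  true  = tt
  table false false true  false = tt
  table false false false true  = tt
  table false false false false = tt

module _ {n : ℕ} where

  degOn-modular : ∀ (D : Div n) S U → degOn D (S ∪ U) + degOn D (S ∩ U) ≡ degOn D S + degOn D U
  degOn-modular D S U = begin
    degOn D (S ∪ U) + degOn D (S ∩ U)                    ≡⟨ sumBy-+ (at (S ∪ U)) (at (S ∩ U)) (allFin n) ⟩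
    sumBy (λ v → at (S ∪ U) v + at (S ∩ U) v) (allFin n) ≡⟨ sumBy-cong pointwise (allFin n) ⟩
    sumBy (λ v → at S v + at U v) (allFin n)             ≡⟨ sumBy-+ (at S) (at U) (allFin n) ⟨
    degOn D S + degOn D U                                ∎
    where
    open ≡-Reasoning
    at : Subset n → Fin n → ℤ
    at X v = select (lookup X v) (D v)
    pointwise : ∀ v → at (S ∪ U) v + at (S ∩ U) v ≡ at S v + at U v
    pointwise v rewrite lookup-zipWith _∨_ v S U | lookup-zipWith _∧_ v S U =
      select-∨-∧ (lookup S v) (lookup U v) (D v)

  degOn-⊥ : ∀ (D : Div n) → degOn D ⊥ ≡ + 0
  degOn-⊥ D = sumBy-zero (λ v → cong (λ b → select b (D v)) (lookup-replicate v false)) (allFin n)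

  e-⊥ : ∀ (G : Multigraph n) → e G ⊥ ≡ 0
  e-⊥ G = countBy-false (λ (u , v) → cong (_∧ lookup ⊥ v) (lookup-replicate u false)) (edges G)

  e-supermodular : ∀ (G : Multigraph n) S U → e G S ℕ.+ e G U ℕ.≤ e G (S ∪ U) ℕ.+ e G (S ∩ U)
  e-supermodular G S U = countBy-+-mono-≤ pointwise (edges G)
    where
    spans : Subset n → Fin n × Fin n → Bool
    spans X (u , v) = lookup X u ∧ lookup X v
    pointwise : ∀ ed → indicator (spans S ed) ℕ.+ indicator (spans U ed)
                     ℕ.≤ indicator (spans (S ∪ U) ed) ℕ.+ indicator (spans (S ∩ U) ed)
    pointwise (u , v) rewrite lookup-zipWith _∨_ u S U | lookup-zipWith _∧_ u S U
                            | lookup-zipWith _∨_ v S U | lookup-zipWith _∧_ v S U =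
      indicator-∧-supermodular (lookup S u) (lookup U u) (lookup S v) (lookup U v)

module _ {n : ℕ} (G : Multigraph n) (D : Div n) where

  χ-submodular : Submodular (λ S → χ G S D)
  χ-submodular S U = begin
    χ G (S ∪ U) D + χ G (S ∩ U) D
      ≡⟨ regroup (degOn D (S ∪ U)) (+ ∣ S ∪ U ∣) (+ e G (S ∪ U))
                 (degOn D (S ∩ U)) (+ ∣ S ∩ U ∣) (+ e G (S ∩ U)) ⟩
    (degOn D (S ∪ U) + degOn D (S ∩ U)) + (+ ∣ S ∪ U ∣ + + ∣ S ∩ U ∣) - (+ e G (S ∪ U) + + e G (S ∩ U))
      ≡⟨ cong₂ (λ deg card → deg + card - (+ e G (S ∪ U) + + e G (S ∩ U)))
               (degOn-modular D S U) card-modular ⟩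
    (degOn D S + degOn D U) + (+ ∣ S ∣ + + ∣ U ∣) - (+ e G (S ∪ U) + + e G (S ∩ U))
      ≤⟨ ℤ.+-monoʳ-≤ ((degOn D S + degOn D U) + (+ ∣ S ∣ + + ∣ U ∣)) (ℤ.neg-mono-≤ e-supermodularℤ) ⟩
    (degOn D S + degOn D U) + (+ ∣ S ∣ + + ∣ U ∣) - (+ e G S + + e G U)
      ≡⟨ regroup (degOn D S) (+ ∣ S ∣) (+ e G S) (degOn D U) (+ ∣ U ∣) (+ e G U) ⟨
    χ G S D + χ G U D ∎
    where
    open ℤ.≤-Reasoning
    regroup : ∀ a b c a′ b′ c′ → (a + b - c) + (a′ + b′ - c′) ≡ (a + a′) + (b + b′) - (c + c′)
    regroup = solve-∀
    card-modular : + ∣ S ∪ U ∣ + + ∣ S ∩ U ∣ ≡ + ∣ S ∣ + + ∣ U ∣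
    card-modular = trans (sym (ℤ.pos-+ ∣ S ∪ U ∣ ∣ S ∩ U ∣))
                     (trans (cong +_ (∣p∪q∣+∣p∩q∣≡∣p∣+∣q∣ S U)) (ℤ.pos-+ ∣ S ∣ ∣ U ∣))
    e-supermodularℤ : + e G S + + e G U ≤ + e G (S ∪ U) + + e G (S ∩ U)
    e-supermodularℤ = subst₂ _≤_ (ℤ.pos-+ (e G S) (e G U)) (ℤ.pos-+ (e G (S ∪ U)) (e G (S ∩ U)))
                        (+≤+ (e-supermodular G S U))

  χ-⊥ : χ G ⊥ D ≡ + 0
  χ-⊥ rewrite degOn-⊥ D | ∣⊥∣≡0 n | e-⊥ G = refl

corollary4p4 : (n : ℕ) (G : Multigraph n) → Connected G → (D : Div n) →
    + 0 ≤ χ G ⊤ D → χD<0 G D →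
    ∃ λ S → Minimal𝐒 G D S × (∀ S′ → Minimal𝐒 G D S′ → S′ ≡ S)
corollary4p4 n G _ D 0≤χ⊤ χD<0@(T , T-proper , _)
  with minimalProperMinimiser (λ X → χ G X D) (T , T-proper)
... | S , S-minimal = S , S-minimal , λ S′ S′-minimal →
  minimalProperMinimiser-unique (λ X → χ G X D) (χ-submodular G D) (χ-⊥ G D) 0≤χ⊤ χD<0
                                S′-minimal S-minimal
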